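{- Let $P$ be a finite pure poset of length $r-1$ whose order complex is strongly shellable, and let $\rho$ be the rank function of $\widehat P$. Then for every $S\subseteq[r]$ the rank-selected subposet $P_S=\{x\in P\mid \rho(x)\in S\}$ is strongly shellable (i.e. its order complex is strongly shellable).
   Context: A simplicial complex is a finite family of subsets of a vertex set closed under taking subsets; $\mathcal{F}(\Delta)$ is its set of facets. A linear order $F_1,\dots,F_t$ of $\mathcal{F}(\Delta)$ is a strong shelling order if for every $1\le i<j\le t$ there exists $k$ with $1\le k<j$ such that $|F_j\setminus F_k|=1$, $F_j\setminus F_k\subseteq F_j\setminus F_i$, and $F_k\setminus F_j\subseteq F_i$; $\Delta$ is strongly shellable if such an order exists. The order complex $\Delta(P)$ of a finite poset $P$ has as faces the chains of $P$; $P$ is called strongly shellable if $\Delta(P)$ is. A finite poset is pure if all maximal chains have the same length. $\widehat P=P\cup\{\hat0,\hat1\}$ with $\hat0<x<\hat1$ for all $x\in P$; for pure $P$ of length $r-1$, $\rho(x)$ is the common length of all unrefinable chains from $\hat0$ to $x$ in $\widehat P$, so $\rho(x)\in[r]$ for $x\in P$. -}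

module Defs where

open import Level using (0ℓ)
open import Data.Nat using (ℕ; suc)
open import Data.Fin using (Fin; toℕ; _<_)
open import Data.Fin.Subset using (Subset; _∈_; _⊆_; _─_; ∣_∣)
open import Data.Product using (Σ; ∃; _×_; _,_)
open import Data.Sum using (_⊎_)
open import Relation.Binary.Core using (Rel)
open import Relation.Binary.Definitions using (Decidable)
open import Relation.Binary.Structures using (IsPartialOrder)
open import Relation.Binary.PropositionalEquality using (_≡_)
open import Function.Definitions using (Injective)

Complex : ℕ → Set₁
Complex n = Subset n → Set

IsSimplicialComplex : ∀ {n} → Complex n → Set
IsSimplicialComplex {n} Δ = ∀ (F G : Subset n) → Δ F → G ⊆ F → Δ G

IsFacet : ∀ {n} → Complex n → Subset n → Set
IsFacet {n} Δ F = Δ F × (∀ (G : Subset n) → Δ G → F ⊆ G → G ≡ F)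

record StrongShellingOrder {n : ℕ} (Δ : Complex n) : Set where
  field
    t        : ℕ
    facet    : Fin t → Subset n
    injective : Injective _≡_ _≡_ facet
    isFacet  : ∀ i → IsFacet Δ (facet i)
    complete : ∀ F → IsFacet Δ F → ∃ λ i → facet i ≡ F
    strong   : ∀ (i j : Fin t) → i < j →
               ∃ λ (k : Fin t) → k < j
                 × ∣ facet j ─ facet k ∣ ≡ 1
                 × (facet j ─ facet k) ⊆ (facet j ─ facet i)
                 × (facet k ─ facet j) ⊆ facet i

StronglyShellable : ∀ {n} → Complex n → Set
StronglyShellable Δ = StrongShellingOrder Δ

record FinPoset : Set₁ where
  field
    n      : ℕ
    _≤_    : Rel (Fin n) 0ℓ
    isPartialOrder : IsPartialOrder _≡_ _≤_
    _≤?_   : Decidable _≤_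

module _ (P : FinPoset) where
  open FinPoset P

  IsChain : Subset n → Set
  IsChain C = ∀ x y → x ∈ C → y ∈ C → (x ≤ y) ⊎ (y ≤ x)

  OrderComplex : Complex n
  OrderComplex C = IsChain C

  IsMaximalChain : Subset n → Set
  IsMaximalChain C = IsFacet OrderComplex C

  -- P is pure of length r - 1: every maximal chain has r elements
  IsPureOfLength-1+ : ℕ → Set
  IsPureOfLength-1+ r = ∀ C → IsMaximalChain C → ∣ C ∣ ≡ r

  ↓ : Fin n → Subset n → Set
  ↓ x C = ∀ y → y ∈ C → y ≤ x

  -- C ∪ {0̂} is an unrefinable chain from 0̂ to x in P̂:
  -- C is a maximal chain of the subposet P_{≤x}
  IsSaturatedChainTo : Fin n → Subset n → Set
  IsSaturatedChainTo x C = IsFacet (λ D → IsChain D × ↓ x D) C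

  -- ρ(x) = k in P̂ : the unrefinable chains from 0̂ to x have length k,
  -- i.e. the maximal chains of P_{≤x} have k elements.
  -- (For pure P this is well defined; we require every such chain to
  -- have k elements.)
  HasRank : Fin n → ℕ → Set
  HasRank x k = ∀ C → IsSaturatedChainTo x C → ∣ C ∣ ≡ k

  -- rank-selected subposet P_S for S ⊆ [r]; index i : Fin r stands for i+1
  RankSelected : (r : ℕ) → Subset r → Fin n → Set
  RankSelected r S x = ∃ λ (i : Fin r) → i ∈ S × HasRank x (suc (toℕ i))

  RankSelectedOrderComplex : (r : ℕ) → Subset r → Complex n
  RankSelectedOrderComplex r S C = IsChain C × (∀ x → x ∈ C → RankSelected r S x)

-- The facets of Δ(P_S) are exactly the traces F ∩ P_S of the maximal chains F of P. Indeed, in a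
-- pure poset the rank of x is the size of E ∩ ↓x for any maximal chain E through x (replacing
-- E ∩ ↓x by another saturated chain to x yields again a maximal chain), so every maximal chain
-- meets every rank level, and two elements of a chain with the same rank coincide.
-- Listing the traces of a strong shelling order F₁, …, F_t of Δ(P) and discarding repetitions
-- gives a strong shelling order of Δ(P_S): the witness k of a pair i < j is replaced by the first
-- occurrence of F_k ∩ P_S, and |(F_j ∩ P_S) ∖ (F_k ∩ P_S)| is still 1 because it is at most
-- |F_j ∖ F_k| and, F_j ∩ P_S being a first occurrence and a facet, it is not contained in F_k ∩ P_S.

module Submission where

open import Defs
open import Level using (Level; 0ℓ)
open import Data.Bool.Properties using (T-≡) renaming (_≟_ to _≟ᵇ_)
open import Data.Empty using (⊥-elim)
open import Data.Fin using (Fin; zero; suc; toℕ; _≟_; _<_; _<?_) renaming (_≤_ to _≤ᶠ_)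
open import Data.Fin.Properties using (any?; all?; <-cmp; <-irrefl; <-asym; toℕ<n)
open import Data.Fin.Subset
open import Data.Fin.Subset.Induction using (Acc; acc; ⊂-wellFounded; ⊃-wellFounded)
open import Data.Fin.Subset.Properties
open import Data.Nat using (ℕ; suc; z≤n; s≤s; s≤s⁻¹; _+_) renaming (_≤_ to _≤ℕ_; _<_ to _<ℕ_)
import Data.Nat as ℕ
open import Data.Nat.Properties using (+-suc; +-cancelʳ-≡; ≤-antisym; ≤-<-trans; ≤∧≢⇒<)
import Data.Nat.Properties as ℕₚ
open import Data.Product using (∃; _×_; _,_; proj₁; proj₂)
open import Data.Sum using (_⊎_; inj₁; inj₂; swap)
open import Data.Vec using ([]; _∷_; here; there; tabulate)
open import Data.Vec.Properties using (≡-dec; lookup∘tabulate; []=⇒lookup; lookup⇒[]=)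
open import Function using (_∘_; id; _⇔_; mk⇔)
open import Function.Bundles using (module Equivalence)
open import Function.Definitions using (Injective)
open import Relation.Binary.Definitions using (DecidableEquality; tri<; tri≈; tri>)
open import Relation.Binary.PropositionalEquality using (module ≡-Reasoning; _≡_; _≢_; refl; sym; trans; cong; subst)
open import Relation.Binary.Structures using (IsPartialOrder)
open import Relation.Nullary using (¬_; yes; no; ¬?)
open import Relation.Nullary.Decidable as Dec using (isYes; toWitness; fromWitness; decidable-stable; _×-dec_; _⊎-dec_; _→-dec_)
open import Relation.Unary using (Pred; Decidable)

open Equivalence using (to; from)

private variable
  ℓ : Level
  n t : ℕ

x∈p─q⇒x∉q : ∀ {x : Fin n} (p q : Subset n) → x ∈ p ─ q → x ∉ q
x∈p─q⇒x∉q (_ ∷ p) (outside ∷ q) (there x∈) (there x∈q) = x∈p─q⇒x∉q p q x∈ x∈q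
x∈p─q⇒x∉q (_ ∷ p) (inside  ∷ q) (there x∈) (there x∈q) = x∈p─q⇒x∉q p q x∈ x∈q

∣p∣≡∣p∩q∣+∣p─q∣ : ∀ (p q : Subset n) → ∣ p ∣ ≡ ∣ p ∩ q ∣ + ∣ p ─ q ∣
∣p∣≡∣p∩q∣+∣p─q∣ []            []            = refl
∣p∣≡∣p∩q∣+∣p─q∣ (inside  ∷ p) (inside  ∷ q) = cong suc (∣p∣≡∣p∩q∣+∣p─q∣ p q)
∣p∣≡∣p∩q∣+∣p─q∣ (inside  ∷ p) (outside ∷ q) =
  trans (cong suc (∣p∣≡∣p∩q∣+∣p─q∣ p q)) (sym (+-suc ∣ p ∩ q ∣ ∣ p ─ q ∣))
∣p∣≡∣p∩q∣+∣p─q∣ (outside ∷ p) (inside  ∷ q) = ∣p∣≡∣p∩q∣+∣p─q∣ p q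
∣p∣≡∣p∩q∣+∣p─q∣ (outside ∷ p) (outside ∷ q) = ∣p∣≡∣p∩q∣+∣p─q∣ p q

∣p∪q∣≡∣p∣+∣q∣ : ∀ (p q : Subset n) → (∀ {x} → x ∈ p → x ∉ q) → ∣ p ∪ q ∣ ≡ ∣ p ∣ + ∣ q ∣
∣p∪q∣≡∣p∣+∣q∣ []            []            _        = refl
∣p∪q∣≡∣p∣+∣q∣ (inside  ∷ p) (inside  ∷ q) disjoint = ⊥-elim (disjoint here here)
∣p∪q∣≡∣p∣+∣q∣ (inside  ∷ p) (outside ∷ q) disjoint =
  cong suc (∣p∪q∣≡∣p∣+∣q∣ p q λ x∈p x∈q → disjoint (there x∈p) (there x∈q))
∣p∪q∣≡∣p∣+∣q∣ (outside ∷ p) (inside  ∷ q) disjoint =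
  trans (cong suc (∣p∪q∣≡∣p∣+∣q∣ p q λ x∈p x∈q → disjoint (there x∈p) (there x∈q)))
        (sym (+-suc ∣ p ∣ ∣ q ∣))
∣p∪q∣≡∣p∣+∣q∣ (outside ∷ p) (outside ∷ q) disjoint =
  ∣p∪q∣≡∣p∣+∣q∣ p q λ x∈p x∈q → disjoint (there x∈p) (there x∈q)

x∈p⇒∣p∣≡1+∣p-x∣ : ∀ {x : Fin n} {p} → x ∈ p → ∣ p ∣ ≡ suc ∣ p - x ∣
x∈p⇒∣p∣≡1+∣p-x∣ {x = x} {p = p} x∈p =
  trans (∣p∣≡∣p∩q∣+∣p─q∣ p ⁅ x ⁆) (cong (_+ ∣ p - x ∣) (trans (cong ∣_∣ p∩⁅x⁆≡⁅x⁆) (∣⁅x⁆∣≡1 x)))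
  where
  p∩⁅x⁆≡⁅x⁆ : p ∩ ⁅ x ⁆ ≡ ⁅ x ⁆
  p∩⁅x⁆≡⁅x⁆ = ⊆-antisym (p∩q⊆q p ⁅ x ⁆)
    λ y∈⁅x⁆ → subst (_∈ p ∩ ⁅ x ⁆) (sym (x∈⁅y⁆⇒x≡y x y∈⁅x⁆)) (x∈p∩q⁺ (x∈p , x∈⁅x⁆ x))

0<∣p∣⇒Nonempty : ∀ (p : Subset n) → 0 <ℕ ∣ p ∣ → Nonempty p
0<∣p∣⇒Nonempty (inside  ∷ p) _   = zero , here
0<∣p∣⇒Nonempty (outside ∷ p) 0<∣p∣ with x , x∈p ← 0<∣p∣⇒Nonempty p 0<∣p∣ = suc x , there x∈p

Nonempty⇒0<∣p∣ : ∀ (p : Subset n) → Nonempty p → 0 <ℕ ∣ p ∣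
Nonempty⇒0<∣p∣ p (x , x∈p) = subst (_≤ℕ ∣ p ∣) (∣⁅x⁆∣≡1 x)
  (p⊆q⇒∣p∣≤∣q∣ λ y∈⁅x⁆ → subst (_∈ p) (sym (x∈⁅y⁆⇒x≡y x y∈⁅x⁆)) x∈p)

p⊈q⇒Nonempty[p─q] : ∀ (p q : Subset n) → p ⊈ q → Nonempty (p ─ q)
p⊈q⇒Nonempty[p─q] p q p⊈q with any? (λ x → x ∈? p ×-dec ¬? (x ∈? q))
... | yes (x , x∈p , x∉q) = x , x∈p∧x∉q⇒x∈p─q x∈p x∉q
... | no ∄ = ⊥-elim (p⊈q λ {x} x∈p → decidable-stable (x ∈? q) λ x∉q → ∄ (x , x∈p , x∉q))

p∩r─q∩r⊆p─q : ∀ (p q r : Subset n) → (p ∩ r) ─ (q ∩ r) ⊆ p ─ q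
p∩r─q∩r⊆p─q p q r x∈ = x∈p∧x∉q⇒x∈p─q (p∩q⊆p p r x∈p∩r)
  λ x∈q → x∈p─q⇒x∉q (p ∩ r) (q ∩ r) x∈ (x∈p∩q⁺ (x∈q , p∩q⊆q p r x∈p∩r))
  where x∈p∩r = p─q⊆p (p ∩ r) (q ∩ r) x∈

fromDecidable : {Q : Pred (Fin n) ℓ} → Decidable Q → Subset n
fromDecidable Q? = tabulate (isYes ∘ Q?)

module _ {Q : Pred (Fin n) ℓ} (Q? : Decidable Q) where

  ∈-fromDecidable⁺ : ∀ {x} → Q x → x ∈ fromDecidable Q?
  ∈-fromDecidable⁺ {x} qx =
    lookup⇒[]= x _ (trans (lookup∘tabulate _ x) (to T-≡ (fromWitness {a? = Q? x} qx)))

  ∈-fromDecidable⁻ : ∀ {x} → x ∈ fromDecidable Q? → Q x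
  ∈-fromDecidable⁻ {x} x∈ =
    toWitness {a? = Q? x} (from T-≡ (trans (sym (lookup∘tabulate _ x)) ([]=⇒lookup x∈)))

x∈p⇒x≡y⊎x∈p-y : ∀ {x p} (y : Fin n) → x ∈ p → x ≡ y ⊎ x ∈ p - y
x∈p⇒x≡y⊎x∈p-y {x = x} y x∈p with x ≟ y
... | yes x≡y = inj₁ x≡y
... | no  x≢y = inj₂ (x∈p∧x≢y⇒x∈p-y x∈p x≢y)

x∈p-y⇒x≢y : ∀ {x p} {y : Fin n} → x ∈ p - y → x ≢ y
x∈p-y⇒x≢y {p = p} {y} x∈p-y refl = x∈p─q⇒x∉q p ⁅ y ⁆ x∈p-y (x∈⁅x⁆ y)

record OrderedEnumeration (Q : Pred (Fin t) ℓ) : Set ℓ where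
  field
    size       : ℕ
    index      : Fin size → Fin t
    index-<    : ∀ {a b} → a < b → index a < index b
    satisfies  : ∀ a → Q (index a)
    surjective : ∀ {j} → Q j → ∃ λ a → index a ≡ j

  index-<⁻ : ∀ {a b} → index a < index b → a < b
  index-<⁻ {a} {b} ia<ib with <-cmp a b
  ... | tri< a<b _ _ = a<b
  ... | tri≈ _ refl _ = ⊥-elim (<-irrefl refl ia<ib)
  ... | tri> _ _ b<a = ⊥-elim (<-asym ia<ib (index-< b<a))

enumerate : ∀ {Q : Pred (Fin t) ℓ} → Decidable Q → OrderedEnumeration Q
enumerate {t = 0} Q? = record
  { size = 0 ; index = λ () ; index-< = λ {} ; satisfies = λ () ; surjective = λ {} }
enumerate {t = suc t} {Q = Q} Q? with enumerate (Q? ∘ suc) | Q? zero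
... | E | yes q₀ = record
  { size = suc size ; index = index′ ; index-< = index′-< ; satisfies = satisfies′ ; surjective = surjective′ }
  where
  open OrderedEnumeration E
  index′ : Fin (suc size) → Fin (suc t)
  index′ zero    = zero
  index′ (suc a) = suc (index a)
  index′-< : ∀ {a b} → a < b → index′ a < index′ b
  index′-< {zero}  {suc b} _         = s≤s z≤n
  index′-< {suc a} {suc b} (s≤s a<b) = s≤s (index-< a<b)
  satisfies′ : ∀ a → Q (index′ a)
  satisfies′ zero    = q₀
  satisfies′ (suc a) = satisfies a
  surjective′ : ∀ {j} → Q j → ∃ λ a → index′ a ≡ j
  surjective′ {zero}  _  = zero , refl
  surjective′ {suc j} qj with a , refl ← surjective qj = suc a , refl
... | E | no ¬q₀ = record
  { size = size ; index = suc ∘ index ; index-< = s≤s ∘ index-< ; satisfies = satisfies ; surjective = surjective′ }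
  where
  open OrderedEnumeration E
  surjective′ : ∀ {j} → Q j → ∃ λ a → suc (index a) ≡ j
  surjective′ {zero}  q₀ = ⊥-elim (¬q₀ q₀)
  surjective′ {suc j} qj with a , refl ← surjective qj = a , refl

least : ∀ {R : Pred (Fin t) ℓ} → Decidable R → ∀ {j} → R j →
        ∃ λ i → R i × (∀ {k} → k < i → ¬ R k) × i ≤ᶠ j
least R? {zero} r₀ = zero , r₀ , (λ ()) , z≤n
least R? {suc j} rj with R? zero
... | yes r₀ = zero , r₀ , (λ ()) , z≤n
... | no ¬r₀ with i , ri , earlier , i≤j ← least (R? ∘ suc) rj = suc i , ri , earlier′ , s≤s i≤j
  where
  earlier′ : ∀ {k} → k < suc i → ¬ _
  earlier′ {zero}  _         = ¬r₀
  earlier′ {suc k} (s≤s k<i) = earlier k<i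

module FirstOccurrences {A : Set} (_≟_ : DecidableEquality A) (f : Fin t → A) where

  IsFirstOccurrence : Pred (Fin t) 0ℓ
  IsFirstOccurrence j = ∀ i → i < j → f i ≢ f j

  open OrderedEnumeration (enumerate {Q = IsFirstOccurrence} λ j → all? λ i → (i <? j) →-dec ¬? (f i ≟ f j)) public

  f∘index-injective : Injective _≡_ _≡_ (f ∘ index)
  f∘index-injective {a} {b} fa≡fb with <-cmp a b
  ... | tri< a<b _ _ = ⊥-elim (satisfies b (index a) (index-< a<b) fa≡fb)
  ... | tri≈ _ a≡b _ = a≡b
  ... | tri> _ _ b<a = ⊥-elim (satisfies a (index b) (index-< b<a) (sym fa≡fb))

  firstOccurrence : ∀ j → ∃ λ a → f (index a) ≡ f j × index a ≤ᶠ j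
  firstOccurrence j with least (λ i → f i ≟ f j) {j} refl
  ... | i , fi≡fj , earlier , i≤j
    with surjective {j = i} (λ k k<i fk≡fi → earlier k<i (trans fk≡fi fi≡fj))
  ... | a , refl = a , fi≡fj , i≤j

StrongShellingStep : (Fi Fj Fk : Subset n) → Set
StrongShellingStep Fi Fj Fk = ∣ Fj ─ Fk ∣ ≡ 1 × (Fj ─ Fk) ⊆ (Fj ─ Fi) × (Fk ─ Fj) ⊆ Fi

strongShellingStep-∩ : ∀ {Fi Fj Fk : Subset n} T → StrongShellingStep Fi Fj Fk →
                       Fj ∩ T ⊈ Fk ∩ T → StrongShellingStep (Fi ∩ T) (Fj ∩ T) (Fk ∩ T)
strongShellingStep-∩ {Fi = Fi} {Fj} {Fk} T (∣Fj─Fk∣≡1 , Fj─Fk⊆Fj─Fi , Fk─Fj⊆Fi) Fj∩T⊈Fk∩T =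
  ≤-antisym (subst (∣ Fj ∩ T ─ Fk ∩ T ∣ ≤ℕ_) ∣Fj─Fk∣≡1 (p⊆q⇒∣p∣≤∣q∣ (p∩r─q∩r⊆p─q Fj Fk T)))
            (Nonempty⇒0<∣p∣ _ (p⊈q⇒Nonempty[p─q] _ _ Fj∩T⊈Fk∩T)) ,
  (λ x∈ → x∈p∧x∉q⇒x∈p─q (p─q⊆p _ _ x∈) λ x∈Fi∩T →
    x∈p─q⇒x∉q Fj Fi (Fj─Fk⊆Fj─Fi (p∩r─q∩r⊆p─q Fj Fk T x∈)) (p∩q⊆p Fi T x∈Fi∩T)) ,
  λ x∈ → x∈p∩q⁺ (Fk─Fj⊆Fi (p∩r─q∩r⊆p─q Fk Fj T x∈) , p∩q⊆q Fk T (p─q⊆p _ _ x∈))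

strongShellingOrder-∩ : ∀ {Δ Γ : Complex n} (T : Subset n) → StrongShellingOrder Δ →
  (∀ {F} → IsFacet Δ F → IsFacet Γ (F ∩ T)) →
  (∀ {G} → IsFacet Γ G → ∃ λ F → IsFacet Δ F × F ∩ T ≡ G) →
  StrongShellingOrder Γ
strongShellingOrder-∩ {n} {Δ} {Γ} T shelling facet-∩ ∩-facet = record
  { t         = size
  ; facet     = restrict ∘ index
  ; injective = f∘index-injective
  ; isFacet   = λ a → facet-∩ (isFacet (index a))
  ; complete  = complete′
  ; strong    = strong′
  }
  where
  open StrongShellingOrder shelling renaming (t to length)
  restrict : Fin length → Subset n
  restrict j = facet j ∩ T
  open FirstOccurrences (≡-dec _≟ᵇ_) restrict

  complete′ : ∀ G → IsFacet Γ G → ∃ λ a → restrict (index a) ≡ G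
  complete′ G G-facet with ∩-facet G-facet
  ... | F , F-facet , F∩T≡G with complete F F-facet
  ... | j , refl with firstOccurrence j
  ... | a , ra≡rj , _ = a , trans ra≡rj F∩T≡G

  strong′ : ∀ a b → a < b → ∃ λ c → c < b ×
            StrongShellingStep (restrict (index a)) (restrict (index b)) (restrict (index c))
  strong′ a b a<b with strong (index a) (index b) (index-< a<b)
  ... | k , k<b , step with firstOccurrence k
  ... | c , rc≡rk , c≤k = c , index-<⁻ (≤-<-trans c≤k k<b) ,
      subst (StrongShellingStep _ _) (sym rc≡rk) (strongShellingStep-∩ T step rb⊈rk)
    where
    rb⊈rk : restrict (index b) ⊈ restrict k
    rb⊈rk rb⊆rk = satisfies b k k<b
      (proj₂ (facet-∩ (isFacet (index b))) (restrict k) (proj₁ (facet-∩ (isFacet k))) rb⊆rk)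

module Chains (P : FinPoset) where

  open FinPoset P renaming (n to ∣P∣)
  open IsPartialOrder isPartialOrder using (antisym) renaming (refl to ≤-refl; trans to ≤-trans)

  private variable
    C D E F G : Subset ∣P∣
    g x y z : Fin ∣P∣
    k : ℕ

  Comparable : Fin ∣P∣ → Fin ∣P∣ → Set
  Comparable x y = x ≤ y ⊎ y ≤ x

  down : Fin ∣P∣ → Subset ∣P∣
  down x = fromDecidable (_≤? x)

  ∈-down⁺ : y ≤ x → y ∈ down x
  ∈-down⁺ {x = x} = ∈-fromDecidable⁺ (_≤? x)

  ∈-down⁻ : y ∈ down x → y ≤ x
  ∈-down⁻ {x = x} = ∈-fromDecidable⁻ (_≤? x)

  ↓-∩-down : ∀ C → ↓ P x (C ∩ down x)
  ↓-∩-down C y y∈ = ∈-down⁻ (p∩q⊆q C _ y∈)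

  isChain-⊆ : IsChain P C → D ⊆ C → IsChain P D
  isChain-⊆ C-chain D⊆C x y x∈D y∈D = C-chain x y (D⊆C x∈D) (D⊆C y∈D)

  isChain-⁅⁆ : IsChain P ⁅ x ⁆
  isChain-⁅⁆ {x} y z y∈ z∈ rewrite x∈⁅y⁆⇒x≡y x y∈ | x∈⁅y⁆⇒x≡y x z∈ = inj₁ ≤-refl

  isChain-∪⁅⁆ : IsChain P C → (∀ z → z ∈ C → Comparable z g) → IsChain P (C ∪ ⁅ g ⁆)
  isChain-∪⁅⁆ {C} {g} C-chain g-comparable x y x∈ y∈ with x∈p∪q⁻ C ⁅ g ⁆ x∈ | x∈p∪q⁻ C ⁅ g ⁆ y∈
  ... | inj₁ x∈C | inj₁ y∈C = C-chain x y x∈C y∈C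
  ... | inj₁ x∈C | inj₂ y∈g rewrite x∈⁅y⁆⇒x≡y g y∈g = g-comparable x x∈C
  ... | inj₂ x∈g | inj₁ y∈C rewrite x∈⁅y⁆⇒x≡y g x∈g = swap (g-comparable y y∈C)
  ... | inj₂ x∈g | inj₂ y∈g rewrite x∈⁅y⁆⇒x≡y g x∈g | x∈⁅y⁆⇒x≡y g y∈g = inj₁ ≤-refl

  maximalChain-∋ : IsMaximalChain P E → (∀ z → z ∈ E → Comparable z g) → g ∈ E
  maximalChain-∋ {E} {g} (E-chain , E-maximal) g-comparable =
    subst (g ∈_) (E-maximal (E ∪ ⁅ g ⁆) (isChain-∪⁅⁆ E-chain g-comparable) (p⊆p∪q ⁅ g ⁆))
      (x∈p∪q⁺ (inj₂ (x∈⁅x⁆ g)))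

  extendToMaximalChain : IsChain P C → ∃ λ E → IsMaximalChain P E × C ⊆ E
  extendToMaximalChain {C} = go C (⊃-wellFounded C)
    where
    go : ∀ C → Acc _⊃_ C → IsChain P C → ∃ λ E → IsMaximalChain P E × C ⊆ E
    go C (acc larger) C-chain
      with any? (λ y → ¬? (y ∈? C) ×-dec all? λ z → z ∈? C →-dec (z ≤? y ⊎-dec y ≤? z))
    ... | yes (y , y∉C , y-comparable)
      with go (C ∪ ⁅ y ⁆) (larger (p⊆p∪q ⁅ y ⁆ , y , x∈p∪q⁺ (inj₂ (x∈⁅x⁆ y)) , y∉C))
              (isChain-∪⁅⁆ C-chain y-comparable)
    ...   | E , E-maximal , C∪y⊆E = E , E-maximal , C∪y⊆E ∘ p⊆p∪q ⁅ y ⁆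
    go C (acc _) C-chain | no ∄y = C , (C-chain , maximal) , id
      where
      maximal : ∀ G → IsChain P G → C ⊆ G → G ≡ C
      maximal G G-chain C⊆G = ⊆-antisym G⊆C C⊆G
        where
        G⊆C : G ⊆ C
        G⊆C {g} g∈G with g ∈? C
        ... | yes g∈C = g∈C
        ... | no  g∉C = ⊥-elim (∄y (g , g∉C , λ z z∈C → G-chain z g (C⊆G z∈C) g∈G))

  chain-top : IsChain P C → Nonempty C → ∃ λ m → m ∈ C × ↓ P m C
  chain-top {C} C-chain (_ , x∈C) = go C (⊂-wellFounded C) C-chain x∈C
    where
    go : ∀ C {x} → Acc _⊂_ C → IsChain P C → x ∈ C → ∃ λ m → m ∈ C × ↓ P m C
    go C {x} (acc smaller) C-chain x∈C with nonempty? (C - x)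
    ... | no C-x-empty = x , x∈C , below-x
      where
      below-x : ↓ P x C
      below-x z z∈C with x∈p⇒x≡y⊎x∈p-y x z∈C
      ... | inj₁ refl = ≤-refl
      ... | inj₂ z∈C-x = ⊥-elim (C-x-empty (z , z∈C-x))
    ... | yes (y , y∈C-x)
      with go (C - x) (smaller (x∈p⇒p-x⊂p x∈C)) (isChain-⊆ C-chain (p─q⊆p C ⁅ x ⁆)) y∈C-x
    ...   | m , m∈C-x , below-m with C-chain x m x∈C (p─q⊆p C ⁅ x ⁆ m∈C-x)
    ...     | inj₁ x≤m = m , p─q⊆p C ⁅ x ⁆ m∈C-x , below
      where
      below : ↓ P m C
      below z z∈C with x∈p⇒x≡y⊎x∈p-y x z∈C
      ... | inj₁ refl = x≤m
      ... | inj₂ z∈C-x = below-m z z∈C-x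
    ...     | inj₂ m≤x = x , x∈C , below
      where
      below : ↓ P x C
      below z z∈C with x∈p⇒x≡y⊎x∈p-y x z∈C
      ... | inj₁ refl = ≤-refl
      ... | inj₂ z∈C-x = ≤-trans (below-m z z∈C-x) m≤x

  ∣∩down∣-< : z ∈ C → y ≤ z → y ≢ z → ∣ C ∩ down y ∣ <ℕ ∣ C ∩ down z ∣
  ∣∩down∣-< {z} {C} {y} z∈C y≤z y≢z = p⊂q⇒∣p∣<∣q∣
    ( (λ w∈ → x∈p∩q⁺ (p∩q⊆p C _ w∈ , ∈-down⁺ (≤-trans (∈-down⁻ (p∩q⊆q C _ w∈)) y≤z)))
    , z , x∈p∩q⁺ (z∈C , ∈-down⁺ ≤-refl) , λ z∈ → y≢z (antisym y≤z (∈-down⁻ (p∩q⊆q C _ z∈))))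

  ∣∩down∣-injective : IsChain P C → y ∈ C → z ∈ C → ∣ C ∩ down y ∣ ≡ ∣ C ∩ down z ∣ → y ≡ z
  ∣∩down∣-injective {C} {y} {z} C-chain y∈C z∈C same with y ≟ z
  ... | yes y≡z = y≡z
  ... | no  y≢z with C-chain y z y∈C z∈C
  ...   | inj₁ y≤z = ⊥-elim (ℕₚ.<-irrefl same (∣∩down∣-< z∈C y≤z y≢z))
  ...   | inj₂ z≤y = ⊥-elim (ℕₚ.<-irrefl (sym same) (∣∩down∣-< y∈C z≤y (y≢z ∘ sym)))

  ∣∩down∣-surjective : IsChain P C → k <ℕ ∣ C ∣ → ∃ λ z → z ∈ C × ∣ C ∩ down z ∣ ≡ suc k
  ∣∩down∣-surjective {C} = go C (⊂-wellFounded C)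
    where
    go : ∀ C {k} → Acc _⊂_ C → IsChain P C → k <ℕ ∣ C ∣ → ∃ λ z → z ∈ C × ∣ C ∩ down z ∣ ≡ suc k
    go C {k} (acc smaller) C-chain k<∣C∣
      with chain-top C-chain (0<∣p∣⇒Nonempty C (≤-<-trans z≤n k<∣C∣))
    ... | m , m∈C , below-m with suc k ℕ.≟ ∣ C ∣
    ...   | yes 1+k≡∣C∣ = m , m∈C , trans (cong ∣_∣ C∩down-m≡C) (sym 1+k≡∣C∣)
      where
      C∩down-m≡C : C ∩ down m ≡ C
      C∩down-m≡C = ⊆-antisym (p∩q⊆p C _) λ c∈C → x∈p∩q⁺ (c∈C , ∈-down⁺ (below-m _ c∈C))
    ...   | no 1+k≢∣C∣
      with go (C - m) (smaller (x∈p⇒p-x⊂p m∈C)) (isChain-⊆ C-chain (p─q⊆p C ⁅ m ⁆))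
              (s≤s⁻¹ (subst (suc k <ℕ_) (x∈p⇒∣p∣≡1+∣p-x∣ m∈C) (≤∧≢⇒< k<∣C∣ 1+k≢∣C∣)))
    ...     | z , z∈C-m , level-z = z , p─q⊆p C ⁅ m ⁆ z∈C-m , trans (cong ∣_∣ C∩down-z≡) level-z
      where
      C∩down-z≡ : C ∩ down z ≡ (C - m) ∩ down z
      C∩down-z≡ = ⊆-antisym
        (λ w∈ → x∈p∩q⁺ (x∈p∧x≢y⇒x∈p-y (p∩q⊆p C _ w∈) (w≢m w∈) , p∩q⊆q C _ w∈))
        (λ w∈ → x∈p∩q⁺ (p─q⊆p C ⁅ m ⁆ (p∩q⊆p _ _ w∈) , p∩q⊆q _ _ w∈))
        where
        w≢m : ∀ {w} → w ∈ C ∩ down z → w ≢ m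
        w≢m w∈ refl = x∈p-y⇒x≢y z∈C-m
          (antisym (below-m z (p─q⊆p C ⁅ m ⁆ z∈C-m)) (∈-down⁻ (p∩q⊆q C _ w∈)))

  saturatedChain-∋ : IsSaturatedChainTo P x C → x ∈ C
  saturatedChain-∋ {x} {C} ((C-chain , C↓) , C-maximal) =
    subst (x ∈_) (C-maximal (C ∪ ⁅ x ⁆) (C∪x-chain , C∪x↓) (p⊆p∪q ⁅ x ⁆)) (x∈p∪q⁺ (inj₂ (x∈⁅x⁆ x)))
    where
    C∪x-chain : IsChain P (C ∪ ⁅ x ⁆)
    C∪x-chain = isChain-∪⁅⁆ C-chain λ z z∈C → inj₁ (C↓ z z∈C)
    C∪x↓ : ↓ P x (C ∪ ⁅ x ⁆)
    C∪x↓ y y∈ with x∈p∪q⁻ C ⁅ x ⁆ y∈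
    ... | inj₁ y∈C = C↓ y y∈C
    ... | inj₂ y∈x rewrite x∈⁅y⁆⇒x≡y x y∈x = ≤-refl

  maximalChain-∩-down : IsMaximalChain P E → x ∈ E → IsSaturatedChainTo P x (E ∩ down x)
  maximalChain-∩-down {E} {x} E-maximal@(E-chain , _) x∈E =
    (isChain-⊆ E-chain (p∩q⊆p E _) , ↓-∩-down E) ,
    λ G (G-chain , G↓) E∩down-x⊆G → ⊆-antisym (G⊆ G-chain G↓ E∩down-x⊆G) E∩down-x⊆G
    where
    G⊆ : IsChain P G → ↓ P x G → E ∩ down x ⊆ G → G ⊆ E ∩ down x
    G⊆ {G} G-chain G↓ E∩down-x⊆G {g} g∈G = x∈p∩q⁺ (maximalChain-∋ E-maximal comparable , ∈-down⁺ (G↓ g g∈G))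
      where
      comparable : ∀ z → z ∈ E → Comparable z g
      comparable z z∈E with E-chain z x z∈E x∈E
      ... | inj₁ z≤x = G-chain z g (E∩down-x⊆G (x∈p∩q⁺ (z∈E , ∈-down⁺ z≤x))) g∈G
      ... | inj₂ x≤z = inj₂ (≤-trans (G↓ g g∈G) x≤z)

  maximalChain-splice : IsSaturatedChainTo P x C → IsMaximalChain P E → x ∈ E →
                        IsMaximalChain P (C ∪ (E ─ down x))
  maximalChain-splice {x} {C} {E} C-saturated@((C-chain , C↓) , C-maximal) E-maximal@(E-chain , _) x∈E =
    M-chain , λ G G-chain M⊆G → ⊆-antisym (G⊆M G-chain M⊆G) M⊆G
    where
    U = E ─ down x
    M = C ∪ U

    x≤U : ∀ {u} → u ∈ U → x ≤ u
    x≤U u∈U with E-chain x _ x∈E (p─q⊆p E _ u∈U)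
    ... | inj₁ x≤u = x≤u
    ... | inj₂ u≤x = ⊥-elim (x∈p─q⇒x∉q E (down x) u∈U (∈-down⁺ u≤x))

    M-chain : IsChain P M
    M-chain a b a∈M b∈M with x∈p∪q⁻ C U a∈M | x∈p∪q⁻ C U b∈M
    ... | inj₁ a∈C | inj₁ b∈C = C-chain a b a∈C b∈C
    ... | inj₁ a∈C | inj₂ b∈U = inj₁ (≤-trans (C↓ a a∈C) (x≤U b∈U))
    ... | inj₂ a∈U | inj₁ b∈C = inj₂ (≤-trans (C↓ b b∈C) (x≤U a∈U))
    ... | inj₂ a∈U | inj₂ b∈U = E-chain a b (p─q⊆p E _ a∈U) (p─q⊆p E _ b∈U)

    G⊆M : IsChain P G → M ⊆ G → G ⊆ M
    G⊆M {G} G-chain M⊆G {g} g∈G with g ≤? x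
    ... | yes g≤x = x∈p∪q⁺ (inj₁ (subst (g ∈_) G∩down-x≡C (x∈p∩q⁺ (g∈G , ∈-down⁺ g≤x))))
      where
      G∩down-x≡C : G ∩ down x ≡ C
      G∩down-x≡C = C-maximal (G ∩ down x) (isChain-⊆ G-chain (p∩q⊆p G _) , ↓-∩-down G)
        λ c∈C → x∈p∩q⁺ (M⊆G (x∈p∪q⁺ (inj₁ c∈C)) , ∈-down⁺ (C↓ _ c∈C))
    ... | no  g≰x = x∈p∪q⁺ (inj₂ (x∈p∧x∉q⇒x∈p─q (maximalChain-∋ E-maximal comparable) (g≰x ∘ ∈-down⁻)))
      where
      comparable : ∀ z → z ∈ E → Comparable z g
      comparable z z∈E with z ≤? x | G-chain x g (M⊆G (x∈p∪q⁺ (inj₁ (saturatedChain-∋ C-saturated)))) g∈G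
      ... | yes z≤x | inj₁ x≤g = inj₁ (≤-trans z≤x x≤g)
      ... | yes _   | inj₂ g≤x = ⊥-elim (g≰x g≤x)
      ... | no  z≰x | _        =
        G-chain z g (M⊆G (x∈p∪q⁺ (inj₂ (x∈p∧x∉q⇒x∈p─q z∈E (z≰x ∘ ∈-down⁻))))) g∈G

  hasRank-injective : IsChain P D → y ∈ D → z ∈ D → HasRank P y k → HasRank P z k → y ≡ z
  hasRank-injective D-chain y∈D z∈D y-rank z-rank with extendToMaximalChain D-chain
  ... | E , E-maximal , D⊆E = ∣∩down∣-injective (proj₁ E-maximal) (D⊆E y∈D) (D⊆E z∈D)
    (trans (y-rank _ (maximalChain-∩-down E-maximal (D⊆E y∈D)))
           (sym (z-rank _ (maximalChain-∩-down E-maximal (D⊆E z∈D)))))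

  module Pure {r} (pure : IsPureOfLength-1+ P r) where

    hasRank-∣∩down∣ : IsMaximalChain P E → x ∈ E → HasRank P x ∣ E ∩ down x ∣
    hasRank-∣∩down∣ {E} {x} E-maximal x∈E C C-saturated@((_ , C↓) , _) = +-cancelʳ-≡ _ _ _ (begin
      ∣ C ∣ + ∣ U ∣             ≡⟨ ∣p∪q∣≡∣p∣+∣q∣ C U disjoint ⟨
      ∣ C ∪ U ∣                 ≡⟨ pure _ (maximalChain-splice C-saturated E-maximal x∈E) ⟩
      r                         ≡⟨ pure E E-maximal ⟨
      ∣ E ∣                     ≡⟨ ∣p∣≡∣p∩q∣+∣p─q∣ E (down x) ⟩
      ∣ E ∩ down x ∣ + ∣ U ∣    ∎)
      where
      open ≡-Reasoning
      U = E ─ down x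
      disjoint : ∀ {c} → c ∈ C → c ∉ U
      disjoint c∈C c∈U = x∈p─q⇒x∉q E (down x) c∈U (∈-down⁺ (C↓ _ c∈C))

    rank : Fin ∣P∣ → ℕ
    rank x = ∣ proj₁ (extendToMaximalChain (isChain-⁅⁆ {x})) ∩ down x ∣

    hasRank⇔≡rank : HasRank P x k ⇔ k ≡ rank x
    hasRank⇔≡rank {x} with extendToMaximalChain (isChain-⁅⁆ {x})
    ... | E , E-maximal , x⊆E = mk⇔
      (λ x-rank → sym (x-rank _ (maximalChain-∩-down E-maximal (x⊆E (x∈⁅x⁆ x)))))
      (λ { refl → hasRank-∣∩down∣ E-maximal (x⊆E (x∈⁅x⁆ x)) })

    maximalChain-hasRank : IsMaximalChain P F → (i : Fin r) → ∃ λ z → z ∈ F × HasRank P z (suc (toℕ i))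
    maximalChain-hasRank {F} F-maximal i
      with ∣∩down∣-surjective (proj₁ F-maximal) (subst (toℕ i <ℕ_) (sym (pure F F-maximal)) (toℕ<n i))
    ... | z , z∈F , level-z = z , z∈F , subst (HasRank P z) level-z (hasRank-∣∩down∣ F-maximal z∈F)

    module _ (S : Subset r) where

      rankSelected? : Decidable (RankSelected P r S)
      rankSelected? x = Dec.map
        (mk⇔ (λ (i , i∈S , i≡) → i , i∈S , from hasRank⇔≡rank i≡)
             (λ (i , i∈S , x-rank) → i , i∈S , to hasRank⇔≡rank x-rank))
        (any? λ i → i ∈? S ×-dec suc (toℕ i) ℕ.≟ rank x)

      P[S] : Subset ∣P∣
      P[S] = fromDecidable rankSelected?

      maximalChain-∩-facet : IsMaximalChain P F → IsFacet (RankSelectedOrderComplex P r S) (F ∩ P[S])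
      maximalChain-∩-facet {F} F-maximal@(F-chain , _) =
        (isChain-⊆ F-chain (p∩q⊆p F P[S]) , λ x x∈ → ∈-fromDecidable⁻ rankSelected? (p∩q⊆q F P[S] x∈)) ,
        λ D (D-chain , D-selected) F∩P[S]⊆D →
          ⊆-antisym (λ y∈D → x∈p∩q⁺ (∈F D-chain D-selected F∩P[S]⊆D y∈D ,
                                     ∈-fromDecidable⁺ rankSelected? (D-selected _ y∈D)))
                    F∩P[S]⊆D
        where
        ∈F : IsChain P D → (∀ y → y ∈ D → RankSelected P r S y) → F ∩ P[S] ⊆ D → D ⊆ F
        ∈F {D} D-chain D-selected F∩P[S]⊆D {y} y∈D with D-selected y y∈D
        ... | i , i∈S , y-rank with maximalChain-hasRank F-maximal i
        ... | z , z∈F , z-rank = subst (_∈ F) (sym (hasRank-injective D-chain y∈D z∈D y-rank z-rank)) z∈F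
          where
          z∈D : z ∈ D
          z∈D = F∩P[S]⊆D (x∈p∩q⁺ (z∈F , ∈-fromDecidable⁺ rankSelected? (i , i∈S , z-rank)))

      facet-maximalChain-∩ : IsFacet (RankSelectedOrderComplex P r S) G →
                             ∃ λ F → IsMaximalChain P F × F ∩ P[S] ≡ G
      facet-maximalChain-∩ ((G-chain , G-selected) , G-maximal) with extendToMaximalChain G-chain
      ... | F , F-maximal , G⊆F = F , F-maximal ,
        G-maximal (F ∩ P[S]) (proj₁ (maximalChain-∩-facet F-maximal))
          λ g∈G → x∈p∩q⁺ (G⊆F g∈G , ∈-fromDecidable⁺ rankSelected? (G-selected _ g∈G))

proposition5p1 : (P : FinPoset) (r : ℕ) →
    IsPureOfLength-1+ P r →
    StronglyShellable (OrderComplex P) →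
    (S : Subset r) →
    StronglyShellable (RankSelectedOrderComplex P r S)
proposition5p1 P r pure shelling S =
  strongShellingOrder-∩ (P[S] S) shelling (maximalChain-∩-facet S) (facet-maximalChain-∩ S)
  where open Chains.Pure P pure
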